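{- Let $a_1$ be a real number with $\frac{6}{5}<a_1<\frac{12}{5}$ and let $A=\bigl(a_1,\frac{1}{\frac56-\frac{1}{a_1}}\bigr)$. Then $a_1$ satisfies at least one of the conditions (i) $\frac65<a_1\le\frac32$, (ii) $\frac32\le a_1\le 2$, (iii) $2\le a_1\le 3$. Moreover: if (i) holds, the periodic schedule $|111112|$ is valid for $A$; if (ii) holds, the periodic schedule $|112|$ is valid for $A$; if (iii) holds, the periodic schedule $|12|$ is valid for $A$.
   Context: A real-valued pinwheel instance is a finite sequence $A=(a_1,\dots,a_k)$ of real numbers $a_i\ge 1$; $a_i$ is the period of task $i$. A schedule is a map $S:\mathbb{Z}\to\{1,\dots,k\}$. $S$ is valid for $A$ if for every task $i$, every positive integer $l$ and every $m\in\mathbb{Z}$, there are at least $l$ integers $t$ with $m\le t< m+\lceil l a_i\rceil$ and $S(t)=i$. A periodic schedule written $|s_0s_1\cdots s_{p-1}|$ denotes the schedule $S(t)=s_{t \bmod p}$ for all $t\in\mathbb{Z}$. -}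

module Defs where

open import Data.Nat as ℕ using (ℕ; zero; suc)
open import Data.Integer as ℤ using (ℤ)
open import Data.Integer.DivMod using (_%ℕ_; n%ℕd<d)
open import Data.Fin as Fin using (Fin; fromℕ<)
open import Data.Vec using (Vec; lookup; []; _∷_)
open import Data.Product using (Σ; _×_; _,_)
open import Data.Sum using (_⊎_)
open import Relation.Nullary using (¬_; does)
open import Relation.Binary.PropositionalEquality using (_≡_)
open import Relation.Binary.Structures using (IsStrictTotalOrder)
open import Algebra.Structures using (IsCommutativeRing)
open import Data.Bool using (if_then_else_)

-- An axiomatisation of the real numbers: a Dedekind-complete ordered field
-- (unique up to isomorphism).  The multiplicative inverse is total, with
-- the field law required only for nonzero arguments.
record RealField : Set₁ where
  infixl 6 _+_
  infixl 7 _*_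
  infix 4 _<_
  field
    Carrier : Set
    0# 1# : Carrier
    _+_ _*_ : Carrier → Carrier → Carrier
    -_ : Carrier → Carrier
    _⁻¹ : Carrier → Carrier
    _<_ : Carrier → Carrier → Set
    isCommutativeRing : IsCommutativeRing _≡_ _+_ _*_ -_ 0# 1#
    0≢1 : ¬ (0# ≡ 1#)
    inverseʳ : ∀ x → ¬ (x ≡ 0#) → x * (x ⁻¹) ≡ 1#
    isStrictTotalOrder : IsStrictTotalOrder _≡_ _<_
    +-mono-< : ∀ x y z → x < y → x + z < y + z
    *-pos : ∀ x y → 0# < x → 0# < y → 0# < x * y
    sup : (P : Carrier → Set) → Σ Carrier P →
          Σ Carrier (λ b → ∀ x → P x → (x < b ⊎ x ≡ b)) →
          Σ Carrier (λ s → (∀ x → P x → (x < s ⊎ x ≡ s)) ×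
                           (∀ b → (∀ x → P x → (x < b ⊎ x ≡ b)) → (s < b ⊎ s ≡ b)))

module _ (R : RealField) where
  open RealField R

  infix 4 _≤ᴿ_
  _≤ᴿ_ : Carrier → Carrier → Set
  x ≤ᴿ y = x < y ⊎ x ≡ y

  _-ᴿ_ : Carrier → Carrier → Carrier
  x -ᴿ y = x + (- y)

  fromℕᴿ : ℕ → Carrier
  fromℕᴿ zero = 0#
  fromℕᴿ (suc n) = fromℕᴿ n + 1#

  frac : ℕ → ℕ → Carrier
  frac p q = fromℕᴿ p * (fromℕᴿ q ⁻¹)

  -- n = ⌈x⌉  (for x > 0, the ceiling is a natural number)
  IsCeil : Carrier → ℕ → Set
  IsCeil x n = (fromℕᴿ n -ᴿ 1# < x) × (x ≤ᴿ fromℕᴿ n)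

  count : {k : ℕ} → (ℤ → Fin k) → Fin k → ℤ → ℕ → ℕ
  count S i m zero = 0
  count S i m (suc n) =
    count S i m n ℕ.+ (if does (S (m ℤ.+ ℤ.+ n) Fin.≟ i) then 1 else 0)

  Valid : {k : ℕ} → (Fin k → Carrier) → (ℤ → Fin k) → Set
  Valid {k} A S = (i : Fin k) (l : ℕ) → 1 ℕ.≤ l → (m : ℤ) (n : ℕ) →
    IsCeil (fromℕᴿ l * A i) n → l ℕ.≤ count S i m n

  -- the instance A = (a₁, 1 / (5/6 − 1/a₁)); task 1 is Fin.zero, task 2 is Fin.suc Fin.zero
  instanceA : Carrier → Fin 2 → Carrier
  instanceA a₁ Fin.zero = a₁
  instanceA a₁ (Fin.suc _) = (frac 5 6 -ᴿ (a₁ ⁻¹)) ⁻¹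

-- the periodic schedule |s₀ s₁ ⋯ s_{p-1}|  (p = suc q ≥ 1)
periodic : {k q : ℕ} → Vec (Fin k) (suc q) → ℤ → Fin k
periodic {k} {q} s t = lookup s (fromℕ< (n%ℕd<d t (suc q)))

t1 t2 : Fin 2
t1 = Fin.zero
t2 = Fin.suc Fin.zero

{-# OPTIONS --safe #-}
module Submission where

-- For each task i we give a rational α/β ≤ aᵢ and show that every window of length n contains
-- at least ⌊βn/α⌋ occurrences of i; this suffices, since ⌈l aᵢ⌉ = n forces αl ≤ βn.  For
-- a₂ = 6a₁/(5a₁ − 6) the bound follows from monotonicity in a₁.  For a schedule of period p,
-- splitting off whole periods reduces the window condition to the finitely many windows of
-- length at most p that start in the first period, and these are checked by evaluation.

open import Defs
open import Data.Nat as ℕ using (ℕ; zero; suc)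
import Data.Nat.Properties as ℕ
open import Data.Integer as ℤ using (ℤ; +_; _%ℕ_; _/ℕ_)
import Data.Integer.Properties as ℤ
open import Data.Integer.DivMod using (n%ℕd<d; a≡a%ℕn+[a/ℕn]*n)
open import Data.Fin as Fin using (Fin; toℕ; fromℕ<)
open import Data.Vec using (Vec; lookup; _∷_; [])
open import Data.Product using (_×_; _,_; proj₁; proj₂; ∃₂)
open import Data.Sum using (_⊎_; inj₁; inj₂)
open import Data.Empty using (⊥-elim)
open import Function using (_∘_)
open import Relation.Binary.PropositionalEquality
open import Relation.Binary.Definitions using (tri<; tri≈; tri>)
open import Relation.Binary.Structures using (IsStrictTotalOrder)
open import Relation.Binary.Bundles using (StrictPartialOrder)
import Relation.Binary.Reasoning.StrictPartialOrder as StrictReasoning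
open import Algebra.Bundles using (CommutativeRing)
open import Algebra.Properties.AbelianGroup ℤ.+-0-abelianGroup using (∙-cancelʳ)
import Algebra.Properties.Ring as RingProperties
import Algebra.Solver.Ring.NaturalCoefficients.Default as SemiringSolver

module _ {d : ℕ} .{{_ : ℕ.NonZero d}} where

  private
    quotient-≤ : ∀ {r r′ q q′} → r′ ℕ.< d → + r ℤ.+ q ℤ.* + d ≡ + r′ ℤ.+ q′ ℤ.* + d → q ℤ.≤ q′
    quotient-≤ {r} {r′} {q} {q′} r′<d eq = ℤ.≮⇒≥ λ q′<q → ℤ.<-irrefl (sym eq) (begin-strict
      + r′ ℤ.+ q′ ℤ.* + d  <⟨ ℤ.+-monoˡ-< (q′ ℤ.* + d) (ℤ.+<+ r′<d) ⟩
      + d ℤ.+ q′ ℤ.* + d   ≡⟨ ℤ.suc-* q′ (+ d) ⟨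
      ℤ.suc q′ ℤ.* + d     ≤⟨ ℤ.*-monoʳ-≤-nonNeg (+ d) (ℤ.i<j⇒suc[i]≤j q′<q) ⟩
      q ℤ.* + d            ≤⟨ ℤ.i≤j+i (q ℤ.* + d) (+ r) ⟩
      + r ℤ.+ q ℤ.* + d    ∎)
      where open ℤ.≤-Reasoning

  %ℕ-unique : ∀ {i q r} → r ℕ.< d → i ≡ + r ℤ.+ q ℤ.* + d → i %ℕ d ≡ r
  %ℕ-unique {i} {q} {r} r<d i≡r+qd = ℤ.+-injective (∙-cancelʳ (q ℤ.* + d) _ _ (begin
    + (i %ℕ d) ℤ.+ q ℤ.* + d         ≡⟨ cong (λ q′ → + (i %ℕ d) ℤ.+ q′ ℤ.* + d) q≡i/d ⟩
    + (i %ℕ d) ℤ.+ (i /ℕ d) ℤ.* + d  ≡⟨ i≡i%d+[i/d]d ⟨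
    i                                ≡⟨ i≡r+qd ⟩
    + r ℤ.+ q ℤ.* + d                ∎))
    where
    open ≡-Reasoning
    i≡i%d+[i/d]d : i ≡ + (i %ℕ d) ℤ.+ (i /ℕ d) ℤ.* + d
    i≡i%d+[i/d]d = a≡a%ℕn+[a/ℕn]*n i d
    q≡i/d : q ≡ i /ℕ d
    q≡i/d = ℤ.≤-antisym
      (quotient-≤ (n%ℕd<d i d) (trans (sym i≡r+qd) i≡i%d+[i/d]d))
      (quotient-≤ r<d (trans (sym i≡i%d+[i/d]d) i≡r+qd))

  [i+k*d]%ℕd≡i%ℕd : ∀ i k → (i ℤ.+ k ℤ.* + d) %ℕ d ≡ i %ℕ d
  [i+k*d]%ℕd≡i%ℕd i k = %ℕ-unique {q = i /ℕ d ℤ.+ k} (n%ℕd<d i d) (begin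
    i ℤ.+ k ℤ.* + d                                    ≡⟨ cong (ℤ._+ k ℤ.* + d) (a≡a%ℕn+[a/ℕn]*n i d) ⟩
    + (i %ℕ d) ℤ.+ (i /ℕ d) ℤ.* + d ℤ.+ k ℤ.* + d      ≡⟨ ℤ.+-assoc (+ (i %ℕ d)) ((i /ℕ d) ℤ.* + d) (k ℤ.* + d) ⟩
    + (i %ℕ d) ℤ.+ ((i /ℕ d) ℤ.* + d ℤ.+ k ℤ.* + d)    ≡⟨ cong (ℤ._+_ (+ (i %ℕ d))) (ℤ.*-distribʳ-+ (+ d) (i /ℕ d) k) ⟨
    + (i %ℕ d) ℤ.+ (i /ℕ d ℤ.+ k) ℤ.* + d              ∎)
    where open ≡-Reasoning

module _ where
  open import Data.Nat
  open import Data.Nat.Properties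
  open import Data.Nat.DivMod using (_%_; _/_; m≡m%n+[m/n]*n; m%n≤n)
  open import Algebra.Properties.CommutativeSemigroup ℤ.+-commutativeSemigroup using (xy∙z≈xz∙y)
  open import Data.Fin.Properties using (fromℕ<-cong; toℕ-fromℕ<; all?)
  open import Data.Bool using (if_then_else_)
  open import Relation.Nullary using (does; Dec)
  open import Relation.Nullary.Decidable using (True; toWitness; _×-dec_)

  module _ (R : RealField) {k : ℕ} (S : ℤ → Fin k) (i : Fin k) where

    private
      indicator : Fin k → ℕ
      indicator s = if does (s Fin.≟ i) then 1 else 0

    count-+ : ∀ m a b → count R S i m (a + b) ≡ count R S i m a + count R S i (m ℤ.+ + a) b
    count-+ m a zero = begin
      count R S i m (a + 0)      ≡⟨ cong (count R S i m) (+-identityʳ a) ⟩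
      count R S i m a            ≡⟨ +-identityʳ _ ⟨
      count R S i m a + 0        ∎
      where open ≡-Reasoning
    count-+ m a (suc b) = begin
      count R S i m (a + suc b)                            ≡⟨ cong (count R S i m) (+-suc a b) ⟩
      count R S i m (a + b) + indicator (S (m ℤ.+ + (a + b)))  ≡⟨ cong₂ _+_ (count-+ m a b) (cong (indicator ∘ S) shift) ⟩
      count R S i m a + count R S i (m ℤ.+ + a) b + indicator (S (m ℤ.+ + a ℤ.+ + b))
                                                           ≡⟨ +-assoc (count R S i m a) _ _ ⟩
      count R S i m a + count R S i (m ℤ.+ + a) (suc b)    ∎
      where
      open ≡-Reasoning
      shift : m ℤ.+ + (a + b) ≡ m ℤ.+ + a ℤ.+ + b
      shift = trans (cong (ℤ._+_ m) (ℤ.pos-+ a b)) (sym (ℤ.+-assoc m (+ a) (+ b)))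

    count-cong : ∀ {m m′} → (∀ j → S (m ℤ.+ + j) ≡ S (m′ ℤ.+ + j)) → ∀ n → count R S i m n ≡ count R S i m′ n
    count-cong same zero = refl
    count-cong same (suc n) = cong₂ _+_ (count-cong same n) (cong indicator (same n))

    -- count S i m n ≥ ⌊β n / α⌋ in every window, stated without division
    HasDensity : ℕ → ℕ → Set
    HasDensity β α = ∀ m n → β * n < α * suc (count R S i m n)

    density-++ : ∀ {β α m a b} →
      β * a ≤ α * count R S i m a →
      β * b < α * suc (count R S i (m ℤ.+ + a) b) →
      β * (a + b) < α * suc (count R S i m (a + b))
    density-++ {β} {α} {m} {a} {b} full rest = begin-strict
      β * (a + b)                    ≡⟨ *-distribˡ-+ β a b ⟩
      β * a + β * b                  <⟨ +-mono-≤-< full rest ⟩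
      α * c₁ + α * suc c₂            ≡⟨ *-distribˡ-+ α c₁ (suc c₂) ⟨
      α * (c₁ + suc c₂)              ≡⟨ cong (α *_) (+-suc c₁ c₂) ⟩
      α * suc (c₁ + c₂)              ≡⟨ cong (λ c → α * suc c) (count-+ m a b) ⟨
      α * suc (count R S i m (a + b)) ∎
      where
      open ≤-Reasoning
      c₁ c₂ : ℕ
      c₁ = count R S i m a
      c₂ = count R S i (m ℤ.+ + a) b

  module _ (R : RealField) {k q : ℕ} (v : Vec (Fin k) (suc q)) (i : Fin k) where

    private
      p : ℕ
      p = suc q
      S : ℤ → Fin k
      S = periodic v

    periodic-+-multiple : ∀ t j → S (t ℤ.+ j ℤ.* + p) ≡ S t
    periodic-+-multiple t j = cong (lookup v) (fromℕ<-cong _ _ ([i+k*d]%ℕd≡i%ℕd t j) _ _)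

    count-periodic-%ℕ : ∀ m n → count R S i m n ≡ count R S i (+ (m %ℕ p)) n
    count-periodic-%ℕ m = count-cong R S i λ j → begin
      S (m ℤ.+ + j)                                   ≡⟨ cong (λ t → S (t ℤ.+ + j)) (a≡a%ℕn+[a/ℕn]*n m p) ⟩
      S (+ (m %ℕ p) ℤ.+ (m /ℕ p) ℤ.* + p ℤ.+ + j)     ≡⟨ cong S (xy∙z≈xz∙y (+ (m %ℕ p)) ((m /ℕ p) ℤ.* + p) (+ j)) ⟩
      S (+ (m %ℕ p) ℤ.+ + j ℤ.+ (m /ℕ p) ℤ.* + p)     ≡⟨ periodic-+-multiple (+ (m %ℕ p) ℤ.+ + j) (m /ℕ p) ⟩
      S (+ (m %ℕ p) ℤ.+ + j)                          ∎
      where open ≡-Reasoning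

    -- Windows of length ≤ p starting in the first period; whole periods must reach βp/α exactly,
    -- without rounding, so that they can be stacked.
    PeriodicDensityCheck : ℕ → ℕ → Set
    PeriodicDensityCheck β α =
      (∀ (r : Fin p) (n : Fin (suc p)) → β * toℕ n < α * suc (count R S i (+ toℕ r) (toℕ n)))
      × (∀ (r : Fin p) → β * p ≤ α * count R S i (+ toℕ r) p)

    periodicDensityCheck? : ∀ β α → Dec (PeriodicDensityCheck β α)
    periodicDensityCheck? β α =
      (all? λ r → all? λ n → _ <? _) ×-dec (all? λ r → _ ≤? _)

    periodic-hasDensity : ∀ β α → {True (periodicDensityCheck? β α)} → HasDensity R S i β α
    periodic-hasDensity β α {checked} m n =
      subst (λ n → β * n < α * suc (count R S i m n)) n≡[n/p]p+n%p
        (periods (n / p) (n % p) m (m%n≤n n p))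
      where
      short : ∀ (r : Fin p) (n : Fin (suc p)) → β * toℕ n < α * suc (count R S i (+ toℕ r) (toℕ n))
      short = proj₁ (toWitness checked)
      full : ∀ (r : Fin p) → β * p ≤ α * count R S i (+ toℕ r) p
      full = proj₂ (toWitness checked)

      at-residue : ∀ {P : ℤ → Set} → (∀ (r : Fin p) → P (+ toℕ r)) → ∀ m → P (+ (m %ℕ p))
      at-residue {P} h m = subst (λ r → P (+ r)) (toℕ-fromℕ< (n%ℕd<d m p)) (h (fromℕ< (n%ℕd<d m p)))

      short-window : ∀ m n → n ≤ p → β * n < α * suc (count R S i m n)
      short-window m n n≤p rewrite count-periodic-%ℕ m n =
        at-residue {λ r → β * n < α * suc (count R S i r n)}
          (λ r → subst (λ n → β * n < α * suc (count R S i (+ toℕ r) n)) (toℕ-fromℕ< (s≤s n≤p))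
                   (short r (fromℕ< (s≤s n≤p))))
          m

      one-period : ∀ m → β * p ≤ α * count R S i m p
      one-period m rewrite count-periodic-%ℕ m p = at-residue {λ r → β * p ≤ α * count R S i r p} full m

      periods : ∀ t r m → r ≤ p → β * (t * p + r) < α * suc (count R S i m (t * p + r))
      periods zero r m r≤p = short-window m r r≤p
      periods (suc t) r m r≤p = subst (λ n → β * n < α * suc (count R S i m n)) (sym (+-assoc p (t * p) r))
        (density-++ R S i {β} {α} (one-period m) (periods t r (m ℤ.+ + p) r≤p))

      n≡[n/p]p+n%p : (n / p) * p + n % p ≡ n
      n≡[n/p]p+n%p = trans (+-comm _ (n % p)) (sym (m≡m%n+[m/n]*n n p))

module _ (R : RealField) where
  open RealField R
  open IsStrictTotalOrder isStrictTotalOrder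
    using (compare; irrefl; asym; isStrictPartialOrder) renaming (trans to <-trans)

  private
    commutativeRing : CommutativeRing _ _
    commutativeRing = record { isCommutativeRing = isCommutativeRing }
    strictPartialOrder : StrictPartialOrder _ _ _
    strictPartialOrder = record { isStrictPartialOrder = isStrictPartialOrder }

    infix 4 _≤_
    _≤_ : Carrier → Carrier → Set
    _≤_ = _≤ᴿ_ R
    infixl 6 _-_
    _-_ : Carrier → Carrier → Carrier
    _-_ = _-ᴿ_ R
    fromℕ : ℕ → Carrier
    fromℕ = fromℕᴿ R

  open CommutativeRing commutativeRing
    using (+-comm; *-comm; *-assoc; +-identityˡ; +-identityʳ; *-identityˡ; *-identityʳ;
           zeroˡ; zeroʳ; distribˡ; -‿inverseʳ; commutativeSemiring; ring)
  open RingProperties ring using (-1*x≈-x; //-rightDividesˡ; -‿involutive)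
  open SemiringSolver commutativeSemiring using (solve; _:=_; _:+_; _:*_; con)
  open StrictReasoning strictPartialOrder

  module StrictlyMonotone {f : Carrier → Carrier} (f-mono : ∀ {x y} → x < y → f x < f y) where

    mono-≤ : ∀ {x y} → x ≤ y → f x ≤ f y
    mono-≤ (inj₁ x<y) = inj₁ (f-mono x<y)
    mono-≤ (inj₂ refl) = inj₂ refl

    cancel-< : ∀ {x y} → f x < f y → x < y
    cancel-< {x} {y} fx<fy with compare x y
    ... | tri< x<y _ _ = x<y
    ... | tri≈ _ refl _ = ⊥-elim (irrefl refl fx<fy)
    ... | tri> _ _ y<x = ⊥-elim (asym fx<fy (f-mono y<x))

    cancel-≤ : ∀ {x y} → f x ≤ f y → x ≤ y
    cancel-≤ {x} {y} fx≤fy with compare x y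
    ... | tri< x<y _ _ = inj₁ x<y
    ... | tri≈ _ x≡y _ = inj₂ x≡y
    ... | tri> _ _ y<x = ⊥-elim (irrefl refl (begin-strict f y <⟨ f-mono y<x ⟩ f x ≤⟨ fx≤fy ⟩ f y ∎))

  +-monoʳ-< : ∀ z {x y} → x < y → x + z < y + z
  +-monoʳ-< z {x} {y} = +-mono-< x y z

  *-monoˡ-< : ∀ {c x y} → 0# < c → x < y → c * x < c * y
  *-monoˡ-< {c} {x} {y} 0<c x<y = begin-strict
    c * x                ≡⟨ +-identityˡ (c * x) ⟨
    0# + c * x           <⟨ +-monoʳ-< (c * x) (*-pos c (y - x) 0<c 0<y-x) ⟩
    c * (y - x) + c * x  ≡⟨ distribˡ c (y - x) x ⟨
    c * (y - x + x)      ≡⟨ cong (c *_) (//-rightDividesˡ x y) ⟩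
    c * y                ∎
    where
    0<y-x : 0# < y - x
    0<y-x = subst (_< y - x) (-‿inverseʳ x) (+-monoʳ-< (- x) x<y)

  *-monoˡ-≤ : ∀ {c x y} → 0# ≤ c → x ≤ y → c * x ≤ c * y
  *-monoˡ-≤ (inj₁ 0<c) = StrictlyMonotone.mono-≤ (*-monoˡ-< 0<c)
  *-monoˡ-≤ {x = x} {y} (inj₂ refl) _ = inj₂ (trans (zeroˡ x) (sym (zeroˡ y)))

  0<1 : 0# < 1#
  0<1 with compare 0# 1#
  ... | tri< 0<1 _ _ = 0<1
  ... | tri≈ _ 0≡1 _ = ⊥-elim (0≢1 0≡1)
  ... | tri> _ _ 1<0 = ⊥-elim (asym 1<0 (subst (0# <_) [-1][-1]≡1 (*-pos _ _ 0<-1 0<-1)))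
    where
    0<-1 : 0# < - 1#
    0<-1 = subst₂ _<_ (-‿inverseʳ 1#) (+-identityˡ (- 1#)) (+-monoʳ-< (- 1#) 1<0)
    [-1][-1]≡1 : - 1# * - 1# ≡ 1#
    [-1][-1]≡1 = trans (-1*x≈-x (- 1#)) (-‿involutive 1#)

  x<x+1 : ∀ x → x < x + 1#
  x<x+1 x = begin-strict
    x         ≡⟨ +-identityˡ x ⟨
    0# + x    <⟨ +-monoʳ-< x 0<1 ⟩
    1# + x    ≡⟨ +-comm 1# x ⟩
    x + 1#    ∎

  fromℕ-+ : ∀ m n → fromℕ (m ℕ.+ n) ≡ fromℕ m + fromℕ n
  fromℕ-+ zero n = sym (+-identityˡ (fromℕ n))
  fromℕ-+ (suc m) n = begin-equality
    fromℕ (m ℕ.+ n) + 1#          ≡⟨ cong (_+ 1#) (fromℕ-+ m n) ⟩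
    fromℕ m + fromℕ n + 1#        ≡⟨ solve 3 (λ a b c → a :+ b :+ c := a :+ c :+ b) refl (fromℕ m) (fromℕ n) 1# ⟩
    fromℕ m + 1# + fromℕ n        ∎

  fromℕ-* : ∀ m n → fromℕ (m ℕ.* n) ≡ fromℕ m * fromℕ n
  fromℕ-* zero n = sym (zeroˡ (fromℕ n))
  fromℕ-* (suc m) n = begin-equality
    fromℕ (n ℕ.+ m ℕ.* n)          ≡⟨ fromℕ-+ n (m ℕ.* n) ⟩
    fromℕ n + fromℕ (m ℕ.* n)      ≡⟨ cong (_+_ (fromℕ n)) (fromℕ-* m n) ⟩
    fromℕ n + fromℕ m * fromℕ n    ≡⟨ solve 2 (λ a b → b :+ a :* b := (a :+ con 1) :* b) refl (fromℕ m) (fromℕ n) ⟩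
    (fromℕ m + 1#) * fromℕ n       ∎

  fromℕ-mono-< : ∀ {m n} → m ℕ.< n → fromℕ m < fromℕ n
  fromℕ-mono-< {m} {suc n} m<1+n with ℕ.m≤n⇒m<n∨m≡n (ℕ.s≤s⁻¹ m<1+n)
  ... | inj₁ m<n = <-trans (fromℕ-mono-< m<n) (x<x+1 (fromℕ n))
  ... | inj₂ refl = x<x+1 (fromℕ n)

  fromℕ-cancel-≤ : ∀ {m n} → fromℕ m ≤ fromℕ n → m ℕ.≤ n
  fromℕ-cancel-≤ {m} {n} Fm≤Fn = ℕ.≮⇒≥ λ n<m →
    irrefl refl (begin-strict fromℕ n <⟨ fromℕ-mono-< {n} {m} n<m ⟩ fromℕ m ≤⟨ Fm≤Fn ⟩ fromℕ n ∎)

  fromℕ-pos : ∀ n → 0# < fromℕ (suc n)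
  fromℕ-pos n = fromℕ-mono-< {0} {suc n} (ℕ.s≤s ℕ.z≤n)

  fromℕ-nonneg : ∀ n → 0# ≤ fromℕ n
  fromℕ-nonneg zero = inj₂ refl
  fromℕ-nonneg (suc n) = inj₁ (fromℕ-pos n)

  fromℕ-1-* : ∀ x → fromℕ 1 * x ≡ x
  fromℕ-1-* x = trans (cong (_* x) (+-identityˡ 1#)) (*-identityˡ x)

  x*x⁻¹≡1 : ∀ {x} → 0# < x → x * x ⁻¹ ≡ 1#
  x*x⁻¹≡1 {x} 0<x = inverseʳ x (λ x≡0 → irrefl (sym x≡0) 0<x)

  ⁻¹-pos : ∀ {x} → 0# < x → 0# < x ⁻¹
  ⁻¹-pos {x} 0<x with compare 0# (x ⁻¹)
  ... | tri< 0<x⁻¹ _ _ = 0<x⁻¹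
  ... | tri≈ _ 0≡x⁻¹ _ = ⊥-elim (0≢1 (begin-equality
    0#          ≡⟨ zeroʳ x ⟨
    x * 0#      ≡⟨ cong (x *_) 0≡x⁻¹ ⟩
    x * x ⁻¹    ≡⟨ x*x⁻¹≡1 0<x ⟩
    1#          ∎))
  ... | tri> _ _ x⁻¹<0 = ⊥-elim (asym 0<1 (begin-strict
    1#          ≡⟨ x*x⁻¹≡1 0<x ⟨
    x * x ⁻¹    <⟨ *-monoˡ-< 0<x x⁻¹<0 ⟩
    x * 0#      ≡⟨ zeroʳ x ⟩
    0#          ∎))

  q*[p/q]≡p : ∀ p q → fromℕ (suc q) * frac R p (suc q) ≡ fromℕ p
  q*[p/q]≡p p q = begin-equality
    s * (fromℕ p * s ⁻¹)   ≡⟨ solve 3 (λ a b c → a :* (b :* c) := b :* (a :* c)) refl s (fromℕ p) (s ⁻¹) ⟩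
    fromℕ p * (s * s ⁻¹)   ≡⟨ cong (fromℕ p *_) (x*x⁻¹≡1 (fromℕ-pos q)) ⟩
    fromℕ p * 1#           ≡⟨ *-identityʳ (fromℕ p) ⟩
    fromℕ p                ∎
    where s = fromℕ (suc q)

  +-cancelʳ-< : ∀ z {x y} → x + z < y + z → x < y
  +-cancelʳ-< z = StrictlyMonotone.cancel-< (+-monoʳ-< z)

  +-cancelʳ-≤ : ∀ z {x y} → x + z ≤ y + z → x ≤ y
  +-cancelʳ-≤ z = StrictlyMonotone.cancel-≤ (+-monoʳ-< z)

  *-cancelˡ-< : ∀ {c x y} → 0# < c → c * x < c * y → x < y
  *-cancelˡ-< 0<c = StrictlyMonotone.cancel-< (*-monoˡ-< 0<c)

  *-cancelˡ-≤ : ∀ {c x y} → 0# < c → c * x ≤ c * y → x ≤ y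
  *-cancelˡ-≤ 0<c = StrictlyMonotone.cancel-≤ (*-monoˡ-< 0<c)

  p/q≤x⇒p≤q*x : ∀ {x} p q → frac R p (suc q) ≤ x → fromℕ p ≤ fromℕ (suc q) * x
  p/q≤x⇒p≤q*x p q p/q≤x = subst (_≤ _) (q*[p/q]≡p p q) (*-monoˡ-≤ (fromℕ-nonneg (suc q)) p/q≤x)

  p/q<x⇒p<q*x : ∀ {x} p q → frac R p (suc q) < x → fromℕ p < fromℕ (suc q) * x
  p/q<x⇒p<q*x p q p/q<x = subst (_< _) (q*[p/q]≡p p q) (*-monoˡ-< (fromℕ-pos q) p/q<x)

  x≤p/q⇒q*x≤p : ∀ {x} p q → x ≤ frac R p (suc q) → fromℕ (suc q) * x ≤ fromℕ p
  x≤p/q⇒q*x≤p p q x≤p/q = subst (_ ≤_) (q*[p/q]≡p p q) (*-monoˡ-≤ (fromℕ-nonneg (suc q)) x≤p/q)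

  ceiling-bound : ∀ {x} α β l n → fromℕ α ≤ fromℕ β * x → IsCeil R (fromℕ l * x) n →
                  α ℕ.* l ℕ.≤ β ℕ.* n
  ceiling-bound {x} α β l n α≤βx (_ , lx≤n) = fromℕ-cancel-≤ (begin
    fromℕ (α ℕ.* l)           ≡⟨ fromℕ-* α l ⟩
    fromℕ α * fromℕ l         ≡⟨ *-comm (fromℕ α) (fromℕ l) ⟩
    fromℕ l * fromℕ α         ≤⟨ *-monoˡ-≤ (fromℕ-nonneg l) α≤βx ⟩
    fromℕ l * (fromℕ β * x)   ≡⟨ solve 3 (λ a b c → a :* (b :* c) := b :* (a :* c)) refl (fromℕ l) (fromℕ β) x ⟩
    fromℕ β * (fromℕ l * x)   ≤⟨ *-monoˡ-≤ (fromℕ-nonneg β) lx≤n ⟩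
    fromℕ β * fromℕ n         ≡⟨ fromℕ-* β n ⟨
    fromℕ (β ℕ.* n)           ∎)

  x*y≤1⇒x≤y⁻¹ : ∀ {x y} → 0# < y → x * y ≤ 1# → x ≤ y ⁻¹
  x*y≤1⇒x≤y⁻¹ {x} {y} 0<y xy≤1 = begin
    x                ≡⟨ *-identityʳ x ⟨
    x * 1#           ≡⟨ cong (x *_) (x*x⁻¹≡1 0<y) ⟨
    x * (y * y ⁻¹)   ≡⟨ solve 3 (λ a b c → a :* (b :* c) := c :* (a :* b)) refl x y (y ⁻¹) ⟩
    y ⁻¹ * (x * y)   ≤⟨ *-monoˡ-≤ (inj₁ (⁻¹-pos 0<y)) xy≤1 ⟩
    y ⁻¹ * 1#        ≡⟨ *-identityʳ (y ⁻¹) ⟩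
    y ⁻¹             ∎

  scale-bound : ∀ {x} b c k e → fromℕ c * x ≤ fromℕ b →
                fromℕ (k ℕ.* c ℕ.+ e) * x ≤ fromℕ (k ℕ.* b) + fromℕ e * x
  scale-bound {x} b c k e cx≤b = begin
    fromℕ (k ℕ.* c ℕ.+ e) * x            ≡⟨ cong (_* x) (trans (fromℕ-+ (k ℕ.* c) e) (cong (_+ fromℕ e) (fromℕ-* k c))) ⟩
    (fromℕ k * fromℕ c + fromℕ e) * x    ≡⟨ solve 4 (λ a b c d → (a :* b :+ c) :* d := a :* (b :* d) :+ c :* d) refl (fromℕ k) (fromℕ c) (fromℕ e) x ⟩
    fromℕ k * (fromℕ c * x) + fromℕ e * x ≤⟨ StrictlyMonotone.mono-≤ (+-monoʳ-< (fromℕ e * x)) (*-monoˡ-≤ (fromℕ-nonneg k) cx≤b) ⟩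
    fromℕ k * fromℕ b + fromℕ e * x      ≡⟨ cong (_+ fromℕ e * x) (fromℕ-* k b) ⟨
    fromℕ (k ℕ.* b) + fromℕ e * x        ∎

  6a[5/6-1/a]+6≡5a : ∀ {a} → 0# < a → fromℕ 6 * a * (frac R 5 6 - a ⁻¹) + fromℕ 6 ≡ fromℕ 5 * a
  6a[5/6-1/a]+6≡5a {a} 0<a = begin-equality
    6a * (5/6 - a ⁻¹) + fromℕ 6          ≡⟨ cong (_+_ (6a * (5/6 - a ⁻¹))) 6≡6a*a⁻¹ ⟩
    6a * (5/6 - a ⁻¹) + 6a * a ⁻¹        ≡⟨ distribˡ 6a (5/6 - a ⁻¹) (a ⁻¹) ⟨
    6a * (5/6 - a ⁻¹ + a ⁻¹)             ≡⟨ cong (6a *_) (//-rightDividesˡ (a ⁻¹) 5/6) ⟩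
    6a * 5/6                             ≡⟨ solve 3 (λ x y z → x :* y :* z := y :* (x :* z)) refl (fromℕ 6) a 5/6 ⟩
    a * (fromℕ 6 * 5/6)                  ≡⟨ cong (a *_) (q*[p/q]≡p 5 5) ⟩
    a * fromℕ 5                          ≡⟨ *-comm a (fromℕ 5) ⟩
    fromℕ 5 * a                          ∎
    where
    6a 5/6 : Carrier
    6a = fromℕ 6 * a
    5/6 = frac R 5 6
    6≡6a*a⁻¹ : fromℕ 6 ≡ 6a * a ⁻¹
    6≡6a*a⁻¹ = begin-equality
      fromℕ 6                 ≡⟨ *-identityʳ (fromℕ 6) ⟨
      fromℕ 6 * 1#            ≡⟨ cong (fromℕ 6 *_) (x*x⁻¹≡1 0<a) ⟨
      fromℕ 6 * (a * a ⁻¹)    ≡⟨ *-assoc (fromℕ 6) a (a ⁻¹) ⟨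
      6a * a ⁻¹               ∎

  -- a₂ = 6a / (5a − 6) decreases in a, so a ≤ b / c gives a₂ ≥ 6b / (5b − 6c) = α;
  -- k certifies (5α − 6) b = 6αc without subtraction.
  second-period-≥ : ∀ {a} b c k α → frac R 6 5 < a → fromℕ c * a ≤ fromℕ b →
                    k ℕ.* c ℕ.+ 6 ≡ 5 ℕ.* α → k ℕ.* b ≡ 6 ℕ.* α →
                    fromℕ α ≤ (frac R 5 6 - a ⁻¹) ⁻¹
  second-period-≥ {a} b c k α 6/5<a ca≤b kc+6≡5α kb≡6α = x*y≤1⇒x≤y⁻¹ 0<u αu≤1
    where
    u 6a : Carrier
    u = frac R 5 6 - a ⁻¹
    6a = fromℕ 6 * a

    6<5a : fromℕ 6 < fromℕ 5 * a
    6<5a = p/q<x⇒p<q*x 6 4 6/5<a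
    0<a : 0# < a
    0<a = *-cancelˡ-< (fromℕ-pos 4) (begin-strict
      fromℕ 5 * 0#   ≡⟨ zeroʳ (fromℕ 5) ⟩
      0#             <⟨ fromℕ-pos 5 ⟩
      fromℕ 6        <⟨ 6<5a ⟩
      fromℕ 5 * a    ∎)
    0<6a : 0# < 6a
    0<6a = *-pos (fromℕ 6) a (fromℕ-pos 5) 0<a

    0<u : 0# < u
    0<u = *-cancelˡ-< 0<6a (subst (_< 6a * u) (sym (zeroʳ 6a)) (+-cancelʳ-< (fromℕ 6) (begin-strict
      0# + fromℕ 6       ≡⟨ +-identityˡ (fromℕ 6) ⟩
      fromℕ 6            <⟨ 6<5a ⟩
      fromℕ 5 * a        ≡⟨ 6a[5/6-1/a]+6≡5a 0<a ⟨
      6a * u + fromℕ 6   ∎)))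

    αu≤1 : fromℕ α * u ≤ 1#
    αu≤1 = *-cancelˡ-≤ 0<6a (+-cancelʳ-≤ (fromℕ (6 ℕ.* α)) (begin
      6a * (fromℕ α * u) + fromℕ (6 ℕ.* α)      ≡⟨ cong (_+_ (6a * (fromℕ α * u))) (fromℕ-* 6 α) ⟩
      6a * (fromℕ α * u) + fromℕ 6 * fromℕ α    ≡⟨ solve 4 (λ x y z w → x :* (y :* z) :+ w :* y := y :* (x :* z :+ w)) refl 6a (fromℕ α) u (fromℕ 6) ⟩
      fromℕ α * (6a * u + fromℕ 6)              ≡⟨ cong (fromℕ α *_) (6a[5/6-1/a]+6≡5a 0<a) ⟩
      fromℕ α * (fromℕ 5 * a)                   ≡⟨ solve 3 (λ x y z → x :* (y :* z) := y :* x :* z) refl (fromℕ α) (fromℕ 5) a ⟩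
      fromℕ 5 * fromℕ α * a                     ≡⟨ cong (_* a) (fromℕ-* 5 α) ⟨
      fromℕ (5 ℕ.* α) * a                       ≤⟨ subst₂ (λ m n → fromℕ m * a ≤ fromℕ n + 6a) kc+6≡5α kb≡6α
                                                     (scale-bound b c k 6 ca≤b) ⟩
      fromℕ (6 ℕ.* α) + 6a                      ≡⟨ +-comm (fromℕ (6 ℕ.* α)) 6a ⟩
      6a + fromℕ (6 ℕ.* α)                      ≡⟨ cong (_+ fromℕ (6 ℕ.* α)) (*-identityʳ 6a) ⟨
      6a * 1# + fromℕ (6 ℕ.* α)                 ∎))

  x≤y⇒x≤1*y : ∀ {x y} → x ≤ y → x ≤ fromℕ 1 * y
  x≤y⇒x≤1*y {x} {y} = subst (x ≤_) (sym (fromℕ-1-* y))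

  x≤y⇒1*x≤y : ∀ {x y} → x ≤ y → fromℕ 1 * x ≤ y
  x≤y⇒1*x≤y {x} {y} = subst (_≤ y) (sym (fromℕ-1-* x))

  valid-if-dense : ∀ {k} {A : Fin k → Carrier} {S : ℤ → Fin k} →
    (∀ i → ∃₂ λ β α → HasDensity R S i β α × fromℕ α ≤ fromℕ β * A i) → Valid R A S
  valid-if-dense {S = S} dense i l _ m n ⌈lA⌉≡n with dense i
  ... | β , α , hasDensity , α≤βA =
    ℕ.s≤s⁻¹ (ℕ.*-cancelˡ-< α l (suc (count R S i m n))
      (ℕ.≤-<-trans (ceiling-bound α β l n α≤βA ⌈lA⌉≡n) (hasDensity m n)))

  module _ {a : Carrier} (6/5<a : frac R 6 5 < a) where

    valid-111112 : a ≤ frac R 3 2 → Valid R (instanceA R a) (periodic (t1 ∷ t1 ∷ t1 ∷ t1 ∷ t1 ∷ t2 ∷ []))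
    valid-111112 a≤3/2 = valid-if-dense λ where
      Fin.zero → 5 , 6 , periodic-hasDensity R (t1 ∷ t1 ∷ t1 ∷ t1 ∷ t1 ∷ t2 ∷ []) t1 5 6 ,
        p/q≤x⇒p≤q*x 6 4 (inj₁ 6/5<a)
      (Fin.suc Fin.zero) → 1 , 6 , periodic-hasDensity R (t1 ∷ t1 ∷ t1 ∷ t1 ∷ t1 ∷ t2 ∷ []) t2 1 6 ,
        x≤y⇒x≤1*y (second-period-≥ 3 2 12 6 6/5<a (x≤p/q⇒q*x≤p 3 1 a≤3/2) refl refl)

    valid-112 : frac R 3 2 ≤ a → a ≤ fromℕ 2 → Valid R (instanceA R a) (periodic (t1 ∷ t1 ∷ t2 ∷ []))
    valid-112 3/2≤a a≤2 = valid-if-dense λ where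
      Fin.zero → 2 , 3 , periodic-hasDensity R (t1 ∷ t1 ∷ t2 ∷ []) t1 2 3 , p/q≤x⇒p≤q*x 3 1 3/2≤a
      (Fin.suc Fin.zero) → 1 , 3 , periodic-hasDensity R (t1 ∷ t1 ∷ t2 ∷ []) t2 1 3 ,
        x≤y⇒x≤1*y (second-period-≥ 2 1 9 3 6/5<a (x≤y⇒1*x≤y a≤2) refl refl)

    valid-12 : fromℕ 2 ≤ a → a ≤ fromℕ 3 → Valid R (instanceA R a) (periodic (t1 ∷ t2 ∷ []))
    valid-12 2≤a a≤3 = valid-if-dense λ where
      Fin.zero → 1 , 2 , periodic-hasDensity R (t1 ∷ t2 ∷ []) t1 1 2 , x≤y⇒x≤1*y 2≤a
      (Fin.suc Fin.zero) → 1 , 2 , periodic-hasDensity R (t1 ∷ t2 ∷ []) t2 1 2 ,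
        x≤y⇒x≤1*y (second-period-≥ 3 1 4 2 6/5<a (x≤y⇒1*x≤y a≤3) refl refl)

    regions : a < frac R 12 5 →
      (frac R 6 5 < a × a ≤ frac R 3 2) ⊎ (frac R 3 2 ≤ a × a ≤ fromℕ 2) ⊎ (fromℕ 2 ≤ a × a ≤ fromℕ 3)
    regions a<12/5 with compare a (frac R 3 2) | compare a (fromℕ 2)
    ... | tri< a<3/2 _ _ | _ = inj₁ (6/5<a , inj₁ a<3/2)
    ... | tri≈ _ a≡3/2 _ | _ = inj₁ (6/5<a , inj₂ a≡3/2)
    ... | tri> _ _ 3/2<a | tri< a<2 _ _ = inj₂ (inj₁ (inj₁ 3/2<a , inj₁ a<2))
    ... | tri> _ _ 3/2<a | tri≈ _ a≡2 _ = inj₂ (inj₁ (inj₁ 3/2<a , inj₂ a≡2))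
    ... | tri> _ _ _ | tri> _ _ 2<a = inj₂ (inj₂ (inj₁ 2<a , a≤3))
      where
      a≤3 : a ≤ fromℕ 3
      a≤3 = *-cancelˡ-≤ (fromℕ-pos 4) (begin
        fromℕ 5 * a          ≤⟨ x≤p/q⇒q*x≤p 12 4 (inj₁ a<12/5) ⟩
        fromℕ 12             <⟨ fromℕ-mono-< {12} {15} (ℕ.m<m+n 12 ℕ.z<s) ⟩
        fromℕ (5 ℕ.* 3)      ≡⟨ fromℕ-* 5 3 ⟩
        fromℕ 5 * fromℕ 3    ∎)

open RealField using (Carrier; _<_)

lemma3 : (R : RealField) (a₁ : Carrier R) →
    _<_ R (frac R 6 5) a₁ → _<_ R a₁ (frac R 12 5) →
    ((_<_ R (frac R 6 5) a₁ × _≤ᴿ_ R a₁ (frac R 3 2))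
      ⊎ (_≤ᴿ_ R (frac R 3 2) a₁ × _≤ᴿ_ R a₁ (fromℕᴿ R 2))
      ⊎ (_≤ᴿ_ R (fromℕᴿ R 2) a₁ × _≤ᴿ_ R a₁ (fromℕᴿ R 3)))
    × ((_<_ R (frac R 6 5) a₁ × _≤ᴿ_ R a₁ (frac R 3 2)) →
        Valid R (instanceA R a₁) (periodic (t1 ∷ t1 ∷ t1 ∷ t1 ∷ t1 ∷ t2 ∷ [])))
    × ((_≤ᴿ_ R (frac R 3 2) a₁ × _≤ᴿ_ R a₁ (fromℕᴿ R 2)) →
        Valid R (instanceA R a₁) (periodic (t1 ∷ t1 ∷ t2 ∷ [])))
    × ((_≤ᴿ_ R (fromℕᴿ R 2) a₁ × _≤ᴿ_ R a₁ (fromℕᴿ R 3)) →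
        Valid R (instanceA R a₁) (periodic (t1 ∷ t2 ∷ [])))
lemma3 R a₁ 6/5<a₁ a₁<12/5 =
    regions R 6/5<a₁ a₁<12/5
  , (λ (_ , a₁≤3/2) → valid-111112 R 6/5<a₁ a₁≤3/2)
  , (λ (3/2≤a₁ , a₁≤2) → valid-112 R 6/5<a₁ 3/2≤a₁ a₁≤2)
  , (λ (2≤a₁ , a₁≤3) → valid-12 R 6/5<a₁ 2≤a₁ a₁≤3)
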